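{- Let $\sigma$ be a player, $G$ a parity game, $X_1\subseteq X_2$ sets of vertices, $\lambda_1\le\lambda_2$ integers, and $A$ a $\overline\sigma$-trap in $G$ with $X_1\subseteq A$. Then $\mathrm{SafeAttr}(G[A],\lambda_1,X_1,\sigma)\subseteq\mathrm{SafeAttr}(G,\lambda_2,X_2,\sigma)$.
   Context: A parity game $G=(V,E,p)$: finite directed graph in which every vertex has an outgoing edge, priorities $p:V\to\mathbb Z$; even-priority vertices belong to Even, odd ones to Odd; $V_\sigma$ the vertices of $\sigma$, $\overline\sigma$ the opponent. A $\overline\sigma$-trap is a set $A$ in which every $\overline\sigma$-vertex has all successors in $A$ and every $\sigma$-vertex has some successor in $A$; $G[A]$ is the induced subgame. $\mathrm{SafeAttr}(H,\lambda,X,\sigma)$, for a game $H$ with vertex set $U$ and successor sets $N_H(v)$, is computed by $C_0=X$, $C_{j+1}=C_j\cup\{v\in U\cap V_\sigma:p(v)<\lambda,\ N_H(v)\cap C_j\ne\emptyset\}\cup\{v\in U\cap V_{\overline\sigma}:p(v)<\lambda,\ N_H(v)\subseteq C_j\}$ until stabilization, returning the final set. -}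

module Defs where

open import Data.Nat using (ℕ; zero; suc)
open import Data.Fin using (Fin)
open import Data.Integer using (ℤ; _<_)
open import Data.Integer.Divisibility using (_∣_)
open import Data.Product using (Σ; ∃; _×_; _,_)
open import Relation.Nullary using (¬_)
open import Level using (0ℓ)

record Game : Set₁ where
  field
    n     : ℕ
    E     : Fin n → Fin n → Set
    p     : Fin n → ℤ
    total : ∀ v → ∃ λ w → E v w
open Game public

data Player : Set where
  Even Odd : Player

opponent : Player → Player
opponent Even = Odd
opponent Odd  = Even

Owns : (G : Game) → Player → Fin (n G) → Set
Owns G Even v = ℤ.pos 2 ∣ p G v
Owns G Odd  v = ¬ (ℤ.pos 2 ∣ p G v)

VSet : Game → Set₁
VSet G = Fin (n G) → Set

Subset : (G : Game) → VSet G → VSet G → Set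
Subset G A B = ∀ (v : Fin (n G)) → A v → B v

IsTrap : (G : Game) → (σ̄ : Player) → VSet G → Set
IsTrap G σ̄ A =
  (∀ v → A v → Owns G σ̄ v → ∀ w → E G v w → A w) ×
  (∀ v → A v → Owns G (opponent σ̄) v → ∃ λ w → E G v w × A w)

-- A "subgame" H of G: vertex set U ⊆ V(G), successor relation N
-- (ownership and priorities inherited from G).
record SubGame (G : Game) : Set₁ where
  field
    U : VSet G
    N : Fin (n G) → Fin (n G) → Set

whole : (G : Game) → SubGame G
whole G = record { U = λ _ → Data.Unit.⊤ ; N = E G }
  where import Data.Unit

induced : (G : Game) → VSet G → SubGame G
induced G A = record { U = A ; N = λ v w → E G v w × A w }

C : (G : Game) → SubGame G → ℤ → VSet G → Player → ℕ → VSet G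
C G H λ' X σ zero    v = X v
C G H λ' X σ (suc j) v =
  C G H λ' X σ j v
  Data.Sum.⊎ (SubGame.U H v × Owns G σ v × p G v < λ'
              × ∃ λ w → SubGame.N H v w × C G H λ' X σ j w)
  Data.Sum.⊎ (SubGame.U H v × Owns G (opponent σ) v × p G v < λ'
              × ∀ w → SubGame.N H v w → C G H λ' X σ j w)
  where import Data.Sum

-- The sequence C_j is increasing and (the vertex set being finite)
-- stabilises; its final value is the union of all C_j.
SafeAttr : (G : Game) → SubGame G → ℤ → VSet G → Player → VSet G
SafeAttr G H λ' X σ v = ∃ λ j → C G H λ' X σ j v

module Submission where

open import Defs
open import Data.Integer using (ℤ; _≤_)
open import Data.Integer.Properties using (<-≤-trans)
open import Data.Nat using (zero; suc)
open import Data.Product using (_×_; _,_; proj₁)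
open import Data.Sum using (inj₁; inj₂)
open import Data.Unit using (tt)

-- The attractor stages only grow when passing to a game that keeps every vertex
-- and every σ-move, and gives the σ̄-vertices no new escape.
record SubGameEmbeds (G : Game) (σ : Player) (H H′ : SubGame G) : Set where
  open SubGame
  field
    vertices    : Subset G (U H) (U H′)
    moves-σ     : ∀ v w → Owns G σ v → N H v w → N H′ v w
    moves-σ̄     : ∀ v → U H v → Owns G (opponent σ) v → ∀ w → N H′ v w → N H v w

module _ {G : Game} {σ : Player} {H H′ : SubGame G} (H⊑H′ : SubGameEmbeds G σ H H′)
         {X₁ X₂ : VSet G} {λ₁ λ₂ : ℤ} (X₁⊆X₂ : Subset G X₁ X₂) (λ₁≤λ₂ : λ₁ ≤ λ₂) where
  open SubGameEmbeds H⊑H′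

  C-mono : ∀ j → Subset G (C G H λ₁ X₁ σ j) (C G H′ λ₂ X₂ σ j)
  C-mono zero    v x = X₁⊆X₂ v x
  C-mono (suc j) v (inj₁ c) = inj₁ (C-mono j v c)
  C-mono (suc j) v (inj₂ (inj₁ (u , o , p<λ , w , e , c))) =
    inj₂ (inj₁ (vertices v u , o , <-≤-trans p<λ λ₁≤λ₂ , w , moves-σ v w o e , C-mono j w c))
  C-mono (suc j) v (inj₂ (inj₂ (u , o , p<λ , all))) =
    inj₂ (inj₂ (vertices v u , o , <-≤-trans p<λ λ₁≤λ₂ ,
                λ w e → C-mono j w (all w (moves-σ̄ v u o w e))))

  SafeAttr-mono : Subset G (SafeAttr G H λ₁ X₁ σ) (SafeAttr G H′ λ₂ X₂ σ)
  SafeAttr-mono v (j , c) = j , C-mono j v c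

induced-embeds-whole : {G : Game} {σ : Player} {A : VSet G} → IsTrap G (opponent σ) A
  → SubGameEmbeds G σ (induced G A) (whole G)
induced-embeds-whole trap = record
  { vertices = λ _ _ → tt
  ; moves-σ  = λ _ _ _ → proj₁
  ; moves-σ̄  = λ v a o w e → e , proj₁ trap v a o w e
  }

mainTheorem12 : (σ : Player) (G : Game) (X₁ X₂ A : VSet G) (λ₁ λ₂ : ℤ)
    → Subset G X₁ X₂ → λ₁ ≤ λ₂
    → IsTrap G (opponent σ) A → Subset G X₁ A
    → Subset G (SafeAttr G (induced G A) λ₁ X₁ σ) (SafeAttr G (whole G) λ₂ X₂ σ)
mainTheorem12 σ G X₁ X₂ A λ₁ λ₂ X₁⊆X₂ λ₁≤λ₂ trap _ =
  SafeAttr-mono (induced-embeds-whole trap) X₁⊆X₂ λ₁≤λ₂
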